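{- Let $n\ge 3$, let $a,b$ be integers such that $r^b$ generates the cyclic subgroup $\langle r\rangle$ of order $n$, and let $S=\{r^af,r^b,r^{ -b}\}\subseteq D_n$. Then (a) $\lambda_1(D_n,S)=\lfloor n/2\rfloor+1$ if $4\mid n$; $\lambda_1(D_n,S)=\lfloor n/2\rfloor$ if $2\mid n$ and $4\nmid n$; $\lambda_1(D_n,S)=\lfloor n/2\rfloor+1$ if $n$ is odd; (b) $\lambda_2(D_n,S)=\lfloor n/2\rfloor$ if $4\mid n$, and $\lambda_2(D_n,S)=\lfloor n/2\rfloor+1$ if $4\nmid n$.
   Context: The dihedral group $D_n$ is the group of order $2n$ with presentation $\langle r,f\mid r^n=f^2=1,\ rf=fr^{ -1}\rangle$. For a generating set $S$ of a finite group $G$ and $g\in G$, $l_S(g)$ is the minimal number of factors in an expression of $g$ as a product of elements of $S$ ($l_S(1)=0$). Define $\lambda_1(G,S)=\max_{g\in G,\,s\in S} l_S(gsg^{ -1})$ and $\lambda_2(G,S)=\max_{g\in G,\,s,s'\in S} l_S(gss'g^{ -1})$. $\lfloor x\rfloor$ is the greatest integer $\le x$. -}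

module Defs where

open import Data.Nat using (ℕ; zero; suc; _+_; _∸_; _≤_; NonZero)
open import Data.Nat.DivMod using (_mod_)
open import Data.Integer using (ℤ; -_)
open import Data.Integer.DivMod using (_%ℕ_)
open import Data.Fin using (Fin; toℕ)
open import Data.Bool using (Bool; true; false; _xor_)
open import Data.Product using (_×_; _,_; Σ; ∃)
open import Data.List using (List; []; _∷_; foldr; length)
open import Data.List.Relation.Unary.All using (All)
open import Data.List.Membership.Propositional using (_∈_)
open import Relation.Binary.PropositionalEquality using (_≡_)

-- Concrete model of the dihedral group D_n (order 2n):
-- the pair (i , e) stands for r^i f^e, with i ∈ Z/n and e ∈ {0,1} (false = 0).
Dih : ℕ → Set
Dih n = Fin n × Bool

module _ (n : ℕ) .{{_ : NonZero n}} where

  -- group law: (r^i f^e)(r^j f^e') = r^(i + (-1)^e j) f^(e+e')  (uses r f = f r⁻¹)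
  _·_ : Dih n → Dih n → Dih n
  (i , false) · (j , e') = ((toℕ i + toℕ j) mod n , e')
  (i , true)  · (j , e') = ((toℕ i + (n ∸ toℕ j)) mod n , true xor e')

  one : Dih n
  one = (0 mod n , false)

  inv : Dih n → Dih n
  inv (i , false) = ((n ∸ toℕ i) mod n , false)
  inv (i , true)  = (i , true)

  rpow : ℤ → Dih n
  rpow k = ((k %ℕ n) mod n , false)

  fl : Dih n
  fl = (0 mod n , true)

  pow : Dih n → ℕ → Dih n
  pow g zero    = one
  pow g (suc m) = g · pow g m

  prod : List (Dih n) → Dih n
  prod = foldr _·_ one

  Word : List (Dih n) → List (Dih n) → Set
  Word S w = All (_∈ S) w

  WordLength : List (Dih n) → Dih n → ℕ → Set
  WordLength S g m =
    Σ (List (Dih n)) (λ w → Word S w × prod w ≡ g × length w ≡ m)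
    × (∀ w → Word S w → prod w ≡ g → m ≤ length w)

  Lambda1 : List (Dih n) → ℕ → Set
  Lambda1 S m =
    (Σ (Dih n) λ g → Σ (Dih n) λ s → s ∈ S × WordLength S (g · (s · inv g)) m)
    × (∀ g s k → s ∈ S → WordLength S (g · (s · inv g)) k → k ≤ m)

  Lambda2 : List (Dih n) → ℕ → Set
  Lambda2 S m =
    (Σ (Dih n) λ g → Σ (Dih n) λ s → Σ (Dih n) λ s' → s ∈ S × s' ∈ S
        × WordLength S (g · ((s · s') · inv g)) m)
    × (∀ g s s' k → s ∈ S → s' ∈ S → WordLength S (g · ((s · s') · inv g)) k → k ≤ m)

module Submission where

-- Since rᵇ generates ⟨r⟩, b is a unit modulo n, so every element is r^(t b) or r^(t b + a) f for a
-- coordinate t ∈ ℤ/n.  The letters σ = rᵃ f, ρ = rᵇ, ρ⁻¹ have coordinates 0, 1, -1; multiplying by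
-- an element adds or subtracts coordinates, and the weight |t| + [x is a reflection] is subadditive.
-- Hence a reflection of coordinate j has length exactly 1 + (distance from j to 0 in ℤ/n), realised
-- by the word ρᶜ σ, and rotations conjugate to rotations of the same weight.  Conjugating a reflection
-- of coordinate t gives exactly the coordinates t + 2y, so λ₁ (resp. λ₂) is one more than the largest
-- distance to 0 of an even (resp. odd) class: products of two letters are ρ⁰, ρ^(±2) or reflections
-- of coordinate ±1.  That largest distance is ⌊n/2⌋, except that for n even the half turn n/2 is
-- missed by the classes of the other parity, which lowers it by one.

module DihedralWordLengths where

  open import Data.Bool using (Bool; true; false; not; _xor_)
  open import Data.Fin using (toℕ)
  import Data.Fin.Properties as Finᵖ
  open import Data.List using (List; []; _∷_; _++_; length; replicate)
  import Data.List.Properties as Listᵖ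
  open import Data.List.Relation.Unary.All using ([]; _∷_)
  open import Data.List.Relation.Unary.All.Properties using (++⁺; replicate⁺)
  open import Data.List.Relation.Unary.Any using (here; there)
  open import Data.List.Membership.Propositional using (_∈_)
  open import Data.Integer using (ℤ; +_; -[1+_]; _+_; _*_; -_; _-_; ∣_∣; _⊖_)
  import Data.Integer.Properties as ℤᵖ
  open import Data.Integer.DivMod using (_%ℕ_; _/ℕ_; a≡a%ℕn+[a/ℕn]*n; n%ℕd<d)
  open import Data.Integer.Tactic.RingSolver using (solve-∀)
  import Data.Nat.Tactic.RingSolver as ℕ-Ring
  open import Data.Nat as ℕ using (ℕ; zero; suc; _≤_; _<_; NonZero; z≤n; s≤s)
  import Data.Nat.Properties as ℕᵖ
  open import Data.Nat.DivMod
    using (_%_; _/_; _mod_; m≡m%n+[m/n]*n; m%n<n; m*n/n≡m; m*n%n≡0; m<n⇒m/n≡0; [m+kn]%n≡m%n; +-distrib-/-∣ʳ)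
  open import Data.Nat.Divisibility using (_∣_; divides; n∣m⇒m%n≡0)
  open import Data.Product using (Σ; ∃; _×_; _,_; proj₁; proj₂)
  open import Data.Sum using (_⊎_; inj₁; inj₂)
  open import Level using (0ℓ)
  open import Relation.Binary.Bundles using (Setoid)
  import Relation.Binary.Reasoning.Setoid
  open import Relation.Binary.PropositionalEquality
    using (_≡_; _≢_; refl; sym; trans; cong; cong₂; subst)
  open import Relation.Nullary using (¬_; contradiction; yes; no)

  open import Defs

  negIf : Bool → ℤ → ℤ
  negIf false x = x
  negIf true  x = - x

  module Congruence (M : ℕ) where

    infix 4 _≈_
    record _≈_ (x y : ℤ) : Set where
      constructor mk≈
      field
        quotient   : ℤ
        difference : x ≡ y + quotient * + M

    ≈-refl : ∀ {x} → x ≈ x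
    ≈-refl {x} = mk≈ (+ 0) (sym (lemma x (+ M)))
      where lemma : ∀ x m → x + + 0 * m ≡ x
            lemma = solve-∀

    ≈-reflexive : ∀ {x y} → x ≡ y → x ≈ y
    ≈-reflexive refl = ≈-refl

    ≈-sym : ∀ {x y} → x ≈ y → y ≈ x
    ≈-sym {y = y} (mk≈ q refl) = mk≈ (- q) (lemma y q (+ M))
      where lemma : ∀ y q m → y ≡ (y + q * m) + (- q) * m
            lemma = solve-∀

    ≈-trans : ∀ {x y z} → x ≈ y → y ≈ z → x ≈ z
    ≈-trans {z = z} (mk≈ q refl) (mk≈ p refl) = mk≈ (p + q) (lemma z p q (+ M))
      where lemma : ∀ z p q m → (z + p * m) + q * m ≡ z + (p + q) * m
            lemma = solve-∀

    ≈-setoid : Setoid 0ℓ 0ℓ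
    ≈-setoid = record
      { Carrier = ℤ ; _≈_ = _≈_
      ; isEquivalence = record { refl = ≈-refl ; sym = ≈-sym ; trans = ≈-trans } }

    module ≈-Reasoning = Relation.Binary.Reasoning.Setoid ≈-setoid

    +-cong : ∀ {x x' y y'} → x ≈ x' → y ≈ y' → x + y ≈ x' + y'
    +-cong {x' = x'} {y' = y'} (mk≈ q refl) (mk≈ p refl) = mk≈ (q + p) (lemma x' y' q p (+ M))
      where lemma : ∀ x y q p m → (x + q * m) + (y + p * m) ≡ (x + y) + (q + p) * m
            lemma = solve-∀

    *-congˡ : ∀ c {x y} → x ≈ y → c * x ≈ c * y
    *-congˡ c {y = y} (mk≈ q refl) = mk≈ (c * q) (lemma c y q (+ M))
      where lemma : ∀ c y q m → c * (y + q * m) ≡ c * y + (c * q) * m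
            lemma = solve-∀

    *-congʳ : ∀ c {x y} → x ≈ y → x * c ≈ y * c
    *-congʳ c {y = y} (mk≈ q refl) = mk≈ (q * c) (lemma c y q (+ M))
      where lemma : ∀ c y q m → (y + q * m) * c ≡ y * c + (q * c) * m
            lemma = solve-∀

    neg-cong : ∀ {x y} → x ≈ y → - x ≈ - y
    neg-cong {y = y} (mk≈ q refl) = mk≈ (- q) (lemma y q (+ M))
      where lemma : ∀ y q m → - (y + q * m) ≡ - y + (- q) * m
            lemma = solve-∀

    negIf-cong : ∀ e {x y} → x ≈ y → negIf e x ≈ negIf e y
    negIf-cong false p = p
    negIf-cong true  p = neg-cong p

    residue : ∀ m .{{_ : NonZero M}} → + (m % M) ≈ + m
    residue m = ≈-sym (mk≈ (+ (m / M)) (begin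
      + m                          ≡⟨ cong +_ (m≡m%n+[m/n]*n m M) ⟩
      + (m % M ℕ.+ m / M ℕ.* M)    ≡⟨ ℤᵖ.pos-+ (m % M) _ ⟩
      + (m % M) + + (m / M ℕ.* M)  ≡⟨ cong (_+_ (+ (m % M))) (ℤᵖ.pos-* (m / M) M) ⟩
      + (m % M) + + (m / M) * + M  ∎))
      where open Relation.Binary.PropositionalEquality.≡-Reasoning

    residueℤ : ∀ z .{{_ : NonZero M}} → + (z %ℕ M) ≈ z
    residueℤ z = ≈-sym (mk≈ (z /ℕ M) (a≡a%ℕn+[a/ℕn]*n z M))

    beyond-modulus : ∀ {x y} k → + x ≡ + y + + suc k * + M → ¬ x < M
    beyond-modulus {x} {y} k eq x<M = ℕᵖ.<⇒≱ x<M (begin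
      M                    ≤⟨ ℕᵖ.m≤m+n M (k ℕ.* M) ⟩
      suc k ℕ.* M          ≤⟨ ℕᵖ.m≤n+m _ y ⟩
      y ℕ.+ suc k ℕ.* M    ≡⟨ ℤᵖ.+-injective (trans (ℤᵖ.pos-+ y _)
                                (trans (cong (_+_ (+ y)) (ℤᵖ.pos-* (suc k) M)) (sym eq))) ⟩
      x                    ∎)
      where open ℕᵖ.≤-Reasoning

    residue-unique : ∀ {x y} → x < M → y < M → + x ≈ + y → x ≡ y
    residue-unique {x} {y} x<M y<M (mk≈ (+ zero) eq) =
      ℤᵖ.+-injective (trans eq (lemma (+ y) (+ M)))
      where lemma : ∀ y m → y + + 0 * m ≡ y
            lemma = solve-∀
    residue-unique x<M y<M (mk≈ (+ suc k) eq) = contradiction x<M (beyond-modulus k eq)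
    residue-unique {x} {y} x<M y<M (mk≈ -[1+ k ] eq) =
      contradiction y<M (beyond-modulus k (trans (lemma (+ y) -[1+ k ] (+ M)) (cong (_+ + suc k * + M) (sym eq))))
      where lemma : ∀ y q m → y ≡ (y + q * m) + (- q) * m
            lemma = solve-∀

  ≈-factor : ∀ K L {x y} → Congruence._≈_ (K ℕ.* L) x y → Congruence._≈_ L x y
  ≈-factor K L {y = y} (Congruence.mk≈ q eq) =
    Congruence.mk≈ (q * + K) (trans eq (trans (cong (λ m → y + q * m) (ℤᵖ.pos-* K L)) (lemma y q (+ K) (+ L))))
    where lemma : ∀ y q k l → y + q * (k * l) ≡ y + (q * k) * l
          lemma = solve-∀

  module Dihedral (n : ℕ) .{{_ : NonZero n}} where
    open Congruence n

    infixl 7 _∙_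
    _∙_ : Dih n → Dih n → Dih n
    _∙_ = _·_ n

    pos : Dih n → ℤ
    pos x = + toℕ (proj₁ x)

    flip : Dih n → Bool
    flip = proj₂

    pos-mod : ∀ m → + toℕ (m mod n) ≈ + m
    pos-mod m = subst (λ k → + k ≈ + m) (sym (Finᵖ.toℕ-fromℕ< (m%n<n m n))) (residue m)

    pos-rpow : ∀ k → pos (rpow n k) ≈ k
    pos-rpow k = ≈-trans (pos-mod (k %ℕ n)) (residueℤ k)

    pos-one : pos (one n) ≈ + 0
    pos-one = pos-mod 0

    pos-fl : pos (fl n) ≈ + 0
    pos-fl = pos-mod 0

    private
      pos-∸ : ∀ {k} → k ≤ n → + (n ℕ.∸ k) ≡ + n - + k
      pos-∸ {k} k≤n = sym (trans (ℤᵖ.m-n≡m⊖n n k) (ℤᵖ.⊖-≥ k≤n))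

    pos-· : ∀ x y → pos (x ∙ y) ≈ pos x + negIf (flip x) (pos y)
    pos-· (i , false) (j , _) = begin
      + toℕ ((toℕ i ℕ.+ toℕ j) mod n)  ≈⟨ pos-mod _ ⟩
      + (toℕ i ℕ.+ toℕ j)              ≡⟨ ℤᵖ.pos-+ (toℕ i) (toℕ j) ⟩
      + toℕ i + + toℕ j                ∎
      where open ≈-Reasoning
    pos-· (i , true) (j , _) = begin
      + toℕ ((toℕ i ℕ.+ (n ℕ.∸ toℕ j)) mod n)  ≈⟨ pos-mod _ ⟩
      + (toℕ i ℕ.+ (n ℕ.∸ toℕ j))              ≡⟨ ℤᵖ.pos-+ (toℕ i) _ ⟩
      + toℕ i + + (n ℕ.∸ toℕ j)                ≡⟨ cong (_+_ (+ toℕ i)) (pos-∸ (ℕᵖ.<⇒≤ (Finᵖ.toℕ<n j))) ⟩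
      + toℕ i + (+ n - + toℕ j)                ≈⟨ mk≈ (+ 1) (lemma (+ toℕ i) (+ toℕ j) (+ n)) ⟩
      + toℕ i - + toℕ j                        ∎
      where
      open ≈-Reasoning
      lemma : ∀ i j n → i + (n - j) ≡ (i - j) + + 1 * n
      lemma = solve-∀

    flip-· : ∀ x y → flip (x ∙ y) ≡ flip x xor flip y
    flip-· (_ , false) _ = refl
    flip-· (_ , true)  _ = refl

    pos-inv : ∀ i → pos (inv n (i , false)) ≈ - + toℕ i
    pos-inv i = begin
      + toℕ ((n ℕ.∸ toℕ i) mod n)  ≈⟨ pos-mod _ ⟩
      + (n ℕ.∸ toℕ i)              ≡⟨ pos-∸ (ℕᵖ.<⇒≤ (Finᵖ.toℕ<n i)) ⟩
      + n - + toℕ i                ≈⟨ mk≈ (+ 1) (lemma (+ toℕ i) (+ n)) ⟩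
      - + toℕ i                    ∎
      where
      open ≈-Reasoning
      lemma : ∀ i n → n - i ≡ - i + + 1 * n
      lemma = solve-∀

    dihedral-ext : ∀ x y → flip x ≡ flip y → pos x ≈ pos y → x ≡ y
    dihedral-ext (i , e) (j , .e) refl p =
      cong (_, e) (Finᵖ.toℕ-injective (residue-unique (Finᵖ.toℕ<n i) (Finᵖ.toℕ<n j) p))

  half-≤ : ∀ {x y} → x ℕ.+ x ≤ suc (y ℕ.+ y) → x ≤ y
  half-≤ {x} {y} le with x ℕᵖ.≤? y
  ... | yes x≤y = x≤y
  ... | no  x≰y = contradiction le (ℕᵖ.<⇒≱ (begin-strict
      suc (y ℕ.+ y)        <⟨ ℕᵖ.n<1+n _ ⟩
      suc (suc (y ℕ.+ y))  ≡⟨ cong suc (sym (ℕᵖ.+-suc y y)) ⟩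
      suc y ℕ.+ suc y      ≤⟨ ℕᵖ.+-mono-≤ (ℕᵖ.≰⇒> x≰y) (ℕᵖ.≰⇒> x≰y) ⟩
      x ℕ.+ x              ∎))
    where open ℕᵖ.≤-Reasoning

  double : ∀ m → m ℕ.* 2 ≡ m ℕ.+ m
  double = ℕ-Ring.solve-∀

  abs-cases : ∀ c → c ≡ + ∣ c ∣ ⊎ c ≡ - + ∣ c ∣
  abs-cases (+ k)    = inj₁ refl
  abs-cases -[1+ k ] = inj₂ refl

  module Residues (n : ℕ) .{{_ : NonZero n}} where
    open Congruence n

    -- Every class has a representative c with 2|c| ≤ n: take r = z mod n, or r - n if r > n/2.
    nearest-rep : ∀ z → Σ ℤ λ c → c ≈ z × ∣ c ∣ ℕ.+ ∣ c ∣ ≤ n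
    nearest-rep z with z %ℕ n ℕ.+ z %ℕ n ℕᵖ.≤? n
    ... | yes small = + (z %ℕ n) , residueℤ z , small
    ... | no  large = - + s , ≈-trans (mk≈ (- + 1) complement) (residueℤ z) ,
                      subst (λ k → k ℕ.+ k ≤ n) (sym (ℤᵖ.∣-i∣≡∣i∣ (+ s))) s+s≤n
      where
      r = z %ℕ n
      s = n ℕ.∸ r
      s+r≡n : s ℕ.+ r ≡ n
      s+r≡n = ℕᵖ.m∸n+n≡m (ℕᵖ.<⇒≤ (n%ℕd<d z n))
      complement : - + s ≡ + r + - + 1 * + n
      complement = trans (lemma (+ s) (+ r)) (cong (λ m → + r + - + 1 * m) (sym (trans (cong +_ (sym s+r≡n)) (ℤᵖ.pos-+ s r))))
        where lemma : ∀ s r → - s ≡ r + - + 1 * (s + r)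
              lemma = solve-∀
      s+s≤n : s ℕ.+ s ≤ n
      s+s≤n = begin
        s ℕ.+ s  ≤⟨ ℕᵖ.+-monoʳ-≤ s (ℕᵖ.<⇒≤ s<r) ⟩
        s ℕ.+ r  ≡⟨ s+r≡n ⟩
        n        ∎
        where
        open ℕᵖ.≤-Reasoning
        s<r : s < r
        s<r = ℕᵖ.+-cancelʳ-< r s r (subst (_< r ℕ.+ r) (sym s+r≡n) (ℕᵖ.≰⇒> large))

    Bounded : ℤ → ℕ → Set
    Bounded p D = ∀ y → Σ ℤ λ c → c ≈ p + (y + y) × ∣ c ∣ ≤ D

    bounded-shift : ∀ {p D} z → Bounded p D → Bounded (p + (z + z)) D
    bounded-shift {p} z bounded y with bounded (y + z)
    ... | c , c≈ , c≤D = c , ≈-trans c≈ (≈-reflexive (lemma p y z)) , c≤D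
      where lemma : ∀ p y z → p + ((y + z) + (y + z)) ≡ (p + (z + z)) + (y + y)
            lemma = solve-∀

    bounded-nearest : ∀ p D → n ≤ suc (D ℕ.+ D) → Bounded p D
    bounded-nearest p D n≤2D+1 y with nearest-rep (p + (y + y))
    ... | c , c≈ , 2c≤n = c , c≈ , half-≤ (ℕᵖ.≤-trans 2c≤n n≤2D+1)

    half-parity : ∀ M {c z} → n ≡ M ℕ.+ M → c ≈ z → ∣ c ∣ ≡ M → Congruence._≈_ 2 (+ M) z
    half-parity M {c} n≡2M c≈z refl =
      Congruence.≈-trans 2 (±M≈M (abs-cases c)) (≈-factor M 2 (subst (λ m → Congruence._≈_ m c _) n≡M*2 c≈z))
      where
      n≡M*2 : n ≡ M ℕ.* 2
      n≡M*2 = trans n≡2M (sym (double ∣ c ∣))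
      ±M≈M : c ≡ + ∣ c ∣ ⊎ c ≡ - + ∣ c ∣ → Congruence._≈_ 2 (+ ∣ c ∣) c
      ±M≈M (inj₁ eq) = Congruence.≈-reflexive 2 (sym eq)
      ±M≈M (inj₂ eq) = Congruence.mk≈ (+ ∣ c ∣) (trans (lemma (+ ∣ c ∣)) (cong (λ x → x + + ∣ c ∣ * + 2) (sym eq)))
        where lemma : ∀ m → m ≡ - m + m * + 2
              lemma = solve-∀

    -- If n = 2M with M = D + 1 of parity different from p, the classes p + 2y avoid ±M,
    -- so their nearest representatives have absolute value at most D.
    bounded-strict : ∀ p D → p < 2 → n ≡ suc D ℕ.+ suc D → suc D % 2 ≢ p → Bounded (+ p) D
    bounded-strict p D p<2 n≡2M parity y with nearest-rep (+ p + (y + y))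
    ... | c , c≈ , 2c≤n
        with ℕᵖ.m≤n⇒m<n∨m≡n (half-≤ {∣ c ∣} {suc D}
                               (ℕᵖ.≤-trans 2c≤n (ℕᵖ.m≤n⇒m≤1+n (ℕᵖ.≤-reflexive n≡2M))))
    ...   | inj₁ (s≤s c≤D) = c , c≈ , c≤D
    ...   | inj₂ ∣c∣≡M = contradiction parity-of-M parity
      where
      parity-of-M : suc D % 2 ≡ p
      parity-of-M = Congruence.residue-unique 2 (m%n<n (suc D) 2) p<2
        (Congruence.≈-trans 2 (Congruence.residue 2 (suc D))
          (Congruence.≈-trans 2 (half-parity (suc D) n≡2M c≈ ∣c∣≡M) (Congruence.mk≈ y (lemma (+ p) y))))
        where lemma : ∀ p y → p + (y + y) ≡ p + y * + 2
              lemma = solve-∀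

    -- d is the distance from 0 to j in ℤ/n: either d = j with j ≤ n - j, or d = n - j with n - j ≤ j.
    data IsDistance (j d : ℕ) : Set where
      near : d ≡ j → d ℕ.+ j ≤ n → IsDistance j d
      far  : d ≤ j → d ℕ.+ j ≡ n → IsDistance j d

    -- Writing t = j + q n: for q ≥ 0 we get |t| ≥ j, for q < 0 we get |t| ≥ n - j.
    representative-≥ : ∀ {t j d} → d ≤ j → d ℕ.+ j ≤ n → t ≈ + j → d ≤ ∣ t ∣
    representative-≥ {t} {j} {d} d≤j _ (mk≈ (+ k) eq) = begin
      d              ≤⟨ d≤j ⟩
      j              ≤⟨ ℕᵖ.m≤m+n j (k ℕ.* n) ⟩
      j ℕ.+ k ℕ.* n  ≡⟨ cong ∣_∣ (sym t≡) ⟩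
      ∣ t ∣          ∎
      where
      open ℕᵖ.≤-Reasoning
      t≡ : t ≡ + (j ℕ.+ k ℕ.* n)
      t≡ = trans eq (trans (cong (_+_ (+ j)) (sym (ℤᵖ.pos-* k n))) (sym (ℤᵖ.pos-+ j _)))
    representative-≥ {t} {j} {d} _ d+j≤n (mk≈ -[1+ k ] eq) = begin
      d              ≤⟨ ℕᵖ.m+n≤o⇒m≤o∸n d d+j≤n ⟩
      n ℕ.∸ j        ≤⟨ ℕᵖ.∸-monoˡ-≤ j n≤m ⟩
      m ℕ.∸ j        ≡⟨ sym (ℤᵖ.∣⊖∣-≤ j≤m) ⟩
      ∣ j ⊖ m ∣      ≡⟨ cong ∣_∣ (sym t≡) ⟩
      ∣ t ∣          ∎
      where
      open ℕᵖ.≤-Reasoning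
      m = suc k ℕ.* n
      n≤m : n ≤ m
      n≤m = ℕᵖ.m≤m+n n (k ℕ.* n)
      j≤m : j ≤ m
      j≤m = ℕᵖ.≤-trans (ℕᵖ.m+n≤o⇒n≤o d d+j≤n) n≤m
      t≡ : t ≡ j ⊖ m
      t≡ = trans eq (trans (cong (_+_ (+ j)) (trans (sym (ℤᵖ.neg-distribˡ-* (+ suc k) (+ n)))
             (cong -_ (sym (ℤᵖ.pos-* (suc k) n))))) (ℤᵖ.m-n≡m⊖n j m))

    distance-≤ : ∀ {t j d} → IsDistance j d → t ≈ + j → d ≤ ∣ t ∣
    distance-≤ (near refl d+j≤n) = representative-≥ ℕᵖ.≤-refl d+j≤n
    distance-≤ (far d≤j refl)    = representative-≥ d≤j ℕᵖ.≤-refl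

    distance-rep : ∀ {j d} → IsDistance j d → Σ ℤ λ c → c ≈ + j × ∣ c ∣ ≡ d
    distance-rep (near refl _)        = + _ , ≈-refl , refl
    distance-rep {j} {d} (far _ d+j≡n) = - + d , mk≈ (- + 1) complement , ℤᵖ.∣-i∣≡∣i∣ (+ d)
      where
      complement : - + d ≡ + j + - + 1 * + n
      complement = trans (lemma (+ d) (+ j)) (cong (λ m → + j + - + 1 * m) (trans (sym (ℤᵖ.pos-+ d j)) (cong +_ d+j≡n)))
        where lemma : ∀ d j → - d ≡ j + - + 1 * (d + j)
              lemma = solve-∀

  module Generators (n : ℕ) .{{_ : NonZero n}} (a b : ℤ) where
    open Congruence n
    open Dihedral n

    σ ρ ρ⁻¹ : Dih n
    σ   = rpow n a ∙ fl n
    ρ   = rpow n b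
    ρ⁻¹ = rpow n (- b)

    S : List (Dih n)
    S = σ ∷ ρ ∷ ρ⁻¹ ∷ []

    offset : Bool → ℤ
    offset false = + 0
    offset true  = a

    infix 4 _has-coord_
    record _has-coord_ (x : Dih n) (t : ℤ) : Set where
      constructor coordinate
      field exponent : pos x ≈ t * b + offset (flip x)
    open _has-coord_

    coord-≈ : ∀ {x t t'} → x has-coord t → t ≈ t' → x has-coord t'
    coord-≈ {x} (coordinate hx) t≈t' = coordinate (≈-trans hx (+-cong (*-congʳ b t≈t') (≈-refl {offset (flip x)})))

    coord-· : ∀ {x y t t'} → x has-coord t → y has-coord t' → x ∙ y has-coord t + negIf (flip x) t'
    coord-· {x} {y} {t} {t'} (coordinate hx) (coordinate hy) = coordinate (begin
      pos (x ∙ y)                                                         ≈⟨ pos-· x y ⟩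
      pos x + negIf (flip x) (pos y)                                      ≈⟨ +-cong hx (negIf-cong (flip x) hy) ⟩
      t * b + offset (flip x) + negIf (flip x) (t' * b + offset (flip y))  ≡⟨ algebra (flip x) (flip y) ⟩
      (t + negIf (flip x) t') * b + offset (flip x xor flip y)
        ≡⟨ cong (λ e → (t + negIf (flip x) t') * b + offset e) (sym (flip-· x y)) ⟩
      (t + negIf (flip x) t') * b + offset (flip (x ∙ y))                 ∎)
      where
      open ≈-Reasoning
      algebra : ∀ e e' → t * b + offset e + negIf e (t' * b + offset e') ≡ (t + negIf e t') * b + offset (e xor e')
      algebra false false = lemma t t' b
        where lemma : ∀ t t' b → t * b + + 0 + (t' * b + + 0) ≡ (t + t') * b + + 0
              lemma = solve-∀
      algebra false true  = lemma t t' b a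
        where lemma : ∀ t t' b a → t * b + + 0 + (t' * b + a) ≡ (t + t') * b + a
              lemma = solve-∀
      algebra true  false = lemma t t' b a
        where lemma : ∀ t t' b a → t * b + a + - (t' * b + + 0) ≡ (t + - t') * b + a
              lemma = solve-∀
      algebra true  true  = lemma t t' b a
        where lemma : ∀ t t' b a → t * b + a + - (t' * b + a) ≡ (t + - t') * b + + 0
              lemma = solve-∀

    coord-inv : ∀ {x t} → x has-coord t → inv n x has-coord negIf (not (flip x)) t
    coord-inv {i , false} {t} (coordinate hx) = coordinate (≈-trans (pos-inv i) (≈-trans (neg-cong hx) (≈-reflexive (lemma t b))))
      where lemma : ∀ t b → - (t * b + + 0) ≡ - t * b + + 0
            lemma = solve-∀
    coord-inv {i , true} hx = hx

    coord-one : one n has-coord + 0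
    coord-one = coordinate (≈-trans pos-one (≈-reflexive (lemma b)))
      where lemma : ∀ b → + 0 ≡ + 0 * b + + 0
            lemma = solve-∀

    coord-σ : σ has-coord + 0
    coord-σ = coordinate (≈-trans (pos-· (rpow n a) (fl n)) (≈-trans (+-cong (pos-rpow a) pos-fl) (≈-reflexive (lemma a b))))
      where lemma : ∀ a b → a + + 0 ≡ + 0 * b + a
            lemma = solve-∀

    coord-ρ : ρ has-coord + 1
    coord-ρ = coordinate (≈-trans (pos-rpow b) (≈-reflexive (lemma b)))
      where lemma : ∀ b → b ≡ + 1 * b + + 0
            lemma = solve-∀

    coord-ρ⁻¹ : ρ⁻¹ has-coord - + 1
    coord-ρ⁻¹ = coordinate (≈-trans (pos-rpow (- b)) (≈-reflexive (lemma b)))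
      where lemma : ∀ b → - b ≡ - + 1 * b + + 0
            lemma = solve-∀

    coord-pow : ∀ k → pow n ρ k has-coord + k
    coord-pow zero    = coord-one
    coord-pow (suc k) = coord-· coord-ρ (coord-pow k)

    flip-pow : ∀ k → flip (pow n ρ k) ≡ false
    flip-pow zero    = refl
    flip-pow (suc k) = flip-pow k

    conj : Dih n → Dih n → Dih n
    conj g x = g ∙ (x ∙ inv n g)

    flip-conj : ∀ g x → flip (conj g x) ≡ flip x
    flip-conj (_ , false) (_ , false) = refl
    flip-conj (_ , false) (_ , true)  = refl
    flip-conj (_ , true)  (_ , false) = refl
    flip-conj (_ , true)  (_ , true)  = refl

    conj-coord : ∀ {g x tg t} → g has-coord tg → x has-coord t →
                 conj g x has-coord tg + negIf (flip g) (t + negIf (flip x) (negIf (not (flip g)) tg))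
    conj-coord hg hx = coord-· hg (coord-· hx (coord-inv hg))

    conj-rotation : ∀ {tg t} g x → flip x ≡ false → g has-coord tg → x has-coord t →
                    conj g x has-coord t ⊎ conj g x has-coord - t
    conj-rotation {tg} {t} (i , false) (j , false) refl hg hx =
      inj₁ (coord-≈ (conj-coord hg hx) (≈-reflexive (lemma tg t)))
      where lemma : ∀ tg t → tg + (t + - tg) ≡ t
            lemma = solve-∀
    conj-rotation {tg} {t} (i , true) (j , false) refl hg hx =
      inj₂ (coord-≈ (conj-coord hg hx) (≈-reflexive (lemma tg t)))
      where lemma : ∀ tg t → tg + - (t + tg) ≡ - t
            lemma = solve-∀

    conj-reflection-by-rotation : ∀ {tg t} g x → flip g ≡ false → flip x ≡ true →
                                  g has-coord tg → x has-coord t → conj g x has-coord t + (tg + tg)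
    conj-reflection-by-rotation {tg} {t} (i , false) (j , true) refl refl hg hx =
      coord-≈ (conj-coord hg hx) (≈-reflexive (lemma tg t))
      where lemma : ∀ tg t → tg + (t + - - tg) ≡ t + (tg + tg)
            lemma = solve-∀

    conj-reflection : ∀ {tg t} g x → flip x ≡ true → g has-coord tg → x has-coord t →
                      Σ ℤ λ y → conj g x has-coord t + (y + y)
    conj-reflection {tg} (i , false) x fx hg hx = tg , conj-reflection-by-rotation (i , false) x refl fx hg hx
    conj-reflection {tg} {t} (i , true) (j , true) refl hg hx =
      tg - t , coord-≈ (conj-coord hg hx) (≈-reflexive (lemma tg t))
      where lemma : ∀ tg t → tg + - (t + - tg) ≡ t + ((tg - t) + (tg - t))
            lemma = solve-∀

    unit-of-generator : (∀ k → ∃ λ m → pow n ρ m ≡ rpow n k) → Σ ℤ λ u → u * b ≈ + 1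
    unit-of-generator generates with generates (+ 1)
    ... | m , ρᵐ≡r = + m , (begin
      + m * b                   ≡⟨ lemma (+ m) b ⟩
      + m * b + offset false    ≡⟨ cong (λ e → + m * b + offset e) (sym (flip-pow m)) ⟩
      + m * b + offset (flip (pow n ρ m))  ≈⟨ ≈-sym (exponent (coord-pow m)) ⟩
      pos (pow n ρ m)           ≡⟨ cong pos ρᵐ≡r ⟩
      pos (rpow n (+ 1))        ≈⟨ pos-rpow (+ 1) ⟩
      + 1                       ∎)
      where
      open ≈-Reasoning
      lemma : ∀ m b → m * b ≡ m * b + + 0
      lemma = solve-∀

    bit : Bool → ℕ
    bit false = 0
    bit true  = 1

    -- weight t e = e + |t|, the length of the word ρᵗ σᵉ.
    weight : ℤ → Bool → ℕ
    weight t e = bit e ℕ.+ ∣ t ∣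

    letter-coord : ∀ {s} → s ∈ S → Σ ℤ λ t → s has-coord t × weight t (flip s) ≡ 1
    letter-coord (here refl)                 = + 0 , coord-σ , refl
    letter-coord (there (here refl))         = + 1 , coord-ρ , refl
    letter-coord (there (there (here refl))) = - + 1 , coord-ρ⁻¹ , refl

    weight-· : ∀ t t' e e' → weight (t + negIf e t') (e xor e') ≤ weight t e ℕ.+ weight t' e'
    weight-· t t' e e' = begin
      bit (e xor e') ℕ.+ ∣ t + negIf e t' ∣
        ≤⟨ ℕᵖ.+-mono-≤ (bit-xor e e') (ℤᵖ.∣i+j∣≤∣i∣+∣j∣ t (negIf e t')) ⟩
      (bit e ℕ.+ bit e') ℕ.+ (∣ t ∣ ℕ.+ ∣ negIf e t' ∣)
        ≡⟨ cong (λ m → (bit e ℕ.+ bit e') ℕ.+ (∣ t ∣ ℕ.+ m)) (abs-negIf e) ⟩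
      (bit e ℕ.+ bit e') ℕ.+ (∣ t ∣ ℕ.+ ∣ t' ∣)         ≡⟨ interchange (bit e) (bit e') ∣ t ∣ ∣ t' ∣ ⟩
      (bit e ℕ.+ ∣ t ∣) ℕ.+ (bit e' ℕ.+ ∣ t' ∣)         ∎
      where
      open ℕᵖ.≤-Reasoning
      bit-xor : ∀ e e' → bit (e xor e') ≤ bit e ℕ.+ bit e'
      bit-xor false _     = ℕᵖ.≤-refl
      bit-xor true  false = ℕᵖ.≤-refl
      bit-xor true  true  = z≤n
      abs-negIf : ∀ e → ∣ negIf e t' ∣ ≡ ∣ t' ∣
      abs-negIf false = refl
      abs-negIf true  = ℤᵖ.∣-i∣≡∣i∣ t'
      interchange : ∀ p q r s → (p ℕ.+ q) ℕ.+ (r ℕ.+ s) ≡ (p ℕ.+ r) ℕ.+ (q ℕ.+ s)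
      interchange = ℕ-Ring.solve-∀

    word-coord : ∀ {w} → Word n S w → Σ ℤ λ t → prod n w has-coord t × weight t (flip (prod n w)) ≤ length w
    word-coord [] = + 0 , coord-one , z≤n
    word-coord {s ∷ w} (s∈S ∷ w∈S) with letter-coord s∈S | word-coord w∈S
    ... | t , hs , weight≡1 | t' , hw , weight≤ = t + negIf (flip s) t' , coord-· hs hw , (begin
      weight (t + negIf (flip s) t') (flip (s ∙ prod n w))            ≡⟨ cong (weight (t + negIf (flip s) t')) (flip-· s (prod n w)) ⟩
      weight (t + negIf (flip s) t') (flip s xor flip (prod n w))     ≤⟨ weight-· t t' (flip s) _ ⟩
      weight t (flip s) ℕ.+ weight t' (flip (prod n w))               ≤⟨ ℕᵖ.+-mono-≤ (ℕᵖ.≤-reflexive weight≡1) weight≤ ⟩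
      suc (length w)                                                  ∎)
      where open ℕᵖ.≤-Reasoning

    power-coord : ∀ {y w t t'} k → flip y ≡ false → y has-coord t → prod n w has-coord t' →
                  prod n (replicate k y ++ w) has-coord + k * t + t' × flip (prod n (replicate k y ++ w)) ≡ flip (prod n w)
    power-coord {t = t} {t'} zero _ _ hw = coord-≈ hw (≈-reflexive (lemma t t')) , refl
      where lemma : ∀ t t' → t' ≡ + 0 * t + t'
            lemma = solve-∀
    power-coord {y = _ , false} {t = t} {t'} (suc k) refl hy hw with power-coord k refl hy hw
    ... | hk , flip≡ = coord-≈ (coord-· hy hk) (≈-reflexive (lemma (+ k) t t')) , flip≡
      where lemma : ∀ k t t' → t + (k * t + t') ≡ (+ 1 + k) * t + t'
            lemma = solve-∀

    rotation-word : ℤ → List (Dih n) → List (Dih n)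
    rotation-word (+ k)    w = replicate k ρ ++ w
    rotation-word -[1+ k ] w = replicate (suc k) ρ⁻¹ ++ w

    rotation-word-coord : ∀ {w t'} c → prod n w has-coord t' →
      prod n (rotation-word c w) has-coord c + t' × flip (prod n (rotation-word c w)) ≡ flip (prod n w)
    rotation-word-coord {t' = t'} (+ k) hw with power-coord k refl coord-ρ hw
    ... | h , flip≡ = coord-≈ h (≈-reflexive (lemma (+ k) t')) , flip≡
      where lemma : ∀ k t' → k * + 1 + t' ≡ k + t'
            lemma = solve-∀
    rotation-word-coord {t' = t'} -[1+ k ] hw with power-coord (suc k) refl coord-ρ⁻¹ hw
    ... | h , flip≡ = coord-≈ h (≈-reflexive (lemma (+ suc k) t')) , flip≡
      where lemma : ∀ k t' → k * - + 1 + t' ≡ - k + t'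
            lemma = solve-∀

    rotation-word-letters : ∀ {w} c → Word n S w → Word n S (rotation-word c w)
    rotation-word-letters (+ k)    w∈S = ++⁺ (replicate⁺ k (there (here refl))) w∈S
    rotation-word-letters -[1+ k ] w∈S = ++⁺ (replicate⁺ (suc k) (there (there (here refl)))) w∈S

    rotation-word-length : ∀ c w → length (rotation-word c w) ≡ ∣ c ∣ ℕ.+ length w
    rotation-word-length (+ k)    w =
      trans (Listᵖ.length-++ (replicate k ρ)) (cong (ℕ._+ length w) (Listᵖ.length-replicate k))
    rotation-word-length -[1+ k ] w =
      trans (Listᵖ.length-++ (replicate (suc k) ρ⁻¹)) (cong (ℕ._+ length w) (Listᵖ.length-replicate (suc k)))

    reflection-word : Bool → List (Dih n)
    reflection-word false = []
    reflection-word true  = σ ∷ []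

    reflection-word-coord : ∀ e → prod n (reflection-word e) has-coord + 0 × flip (prod n (reflection-word e)) ≡ e
    reflection-word-coord false = coord-one , refl
    reflection-word-coord true  = coord-· coord-σ coord-one , refl

    reflection-word-length : ∀ e → length (reflection-word e) ≡ bit e
    reflection-word-length false = refl
    reflection-word-length true  = refl

    reflection-word-letters : ∀ e → Word n S (reflection-word e)
    reflection-word-letters false = []
    reflection-word-letters true  = here refl ∷ []

    module Invertible (u : ℤ) (u*b≈1 : u * b ≈ + 1) where

      -- x has coordinate u (pos x - offset) since (pos x - offset) ≡ (pos x - offset) u b.
      coord-exists : ∀ x → Σ ℤ λ t → x has-coord t
      coord-exists x = u * d , coordinate (begin
        pos x                                ≡⟨ lemma (pos x) (offset (flip x)) ⟩
        d * + 1 + offset (flip x)             ≈⟨ +-cong (*-congˡ d (≈-sym u*b≈1)) ≈-refl ⟩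
        d * (u * b) + offset (flip x)         ≡⟨ cong (_+ offset (flip x)) (lemma' d u b) ⟩
        u * d * b + offset (flip x)           ∎)
        where
        open ≈-Reasoning
        d = pos x - offset (flip x)
        lemma : ∀ p o → p ≡ (p - o) * + 1 + o
        lemma = solve-∀
        lemma' : ∀ d u b → d * (u * b) ≡ u * d * b
        lemma' = solve-∀

      -- Coordinates are unique modulo n: t b ≡ t' b implies t ≡ t' u b ≡ t'.
      coord-unique : ∀ {x t t'} → x has-coord t → x has-coord t' → t ≈ t'
      coord-unique {x} {t} {t'} (coordinate hx) (coordinate hx') = begin
        t                     ≡⟨ sym (ℤᵖ.*-identityʳ t) ⟩
        t * + 1               ≈⟨ *-congˡ t (≈-sym u*b≈1) ⟩
        t * (u * b)           ≡⟨ cancel-offset t u b o ⟩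
        u * (t * b + o - o)   ≈⟨ *-congˡ u (+-cong (≈-trans (≈-sym hx) hx') ≈-refl) ⟩
        u * (t' * b + o - o)  ≡⟨ sym (cancel-offset t' u b o) ⟩
        t' * (u * b)          ≈⟨ *-congˡ t' u*b≈1 ⟩
        t' * + 1              ≡⟨ ℤᵖ.*-identityʳ t' ⟩
        t'                    ∎
        where
        open ≈-Reasoning
        o = offset (flip x)
        cancel-offset : ∀ t u b o → t * (u * b) ≡ u * (t * b + o - o)
        cancel-offset = solve-∀

      coord-ext : ∀ {x y t} → flip x ≡ flip y → x has-coord t → y has-coord t → x ≡ y
      coord-ext {x} {y} {t} fx≡fy (coordinate hx) (coordinate hy) = dihedral-ext x y fx≡fy (begin
        pos x                    ≈⟨ hx ⟩
        t * b + offset (flip x)  ≡⟨ cong (λ e → t * b + offset e) fx≡fy ⟩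
        t * b + offset (flip y)  ≈⟨ ≈-sym hy ⟩
        pos y                    ∎)
        where open ≈-Reasoning

      open Residues n

      word-for : ∀ {x c} → x has-coord c →
                 Σ (List (Dih n)) λ w → Word n S w × prod n w ≡ x × length w ≡ weight c (flip x)
      word-for {x} {c} hx with reflection-word-coord (flip x)
      ... | h₀ , flip₀ with rotation-word-coord c h₀
      ...   | h , flip≡ =
        w , rotation-word-letters c (reflection-word-letters (flip x)) ,
        coord-ext (trans flip≡ flip₀) (coord-≈ h (≈-reflexive (ℤᵖ.+-identityʳ c))) hx ,
        trans (rotation-word-length c _) (trans (cong (∣ c ∣ ℕ.+_) (reflection-word-length (flip x))) (ℕᵖ.+-comm ∣ c ∣ _))
        where w = rotation-word c (reflection-word (flip x))

      length-≤ : ∀ {x c e k} → WordLength n S x k → x has-coord c → flip x ≡ e → k ≤ weight c e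
      length-≤ {e = e} (_ , minimal) hx refl with word-for hx
      ... | w , w∈S , w≡x , |w| = ℕᵖ.≤-trans (minimal w w∈S w≡x) (ℕᵖ.≤-reflexive |w|)

      reflection-length : ∀ {x j d} → flip x ≡ true → x has-coord + j → IsDistance j d → WordLength n S x (suc d)
      reflection-length {x} {j} {d} fx hx dist = attained , minimal
        where
        attained : Σ (List (Dih n)) λ w → Word n S w × prod n w ≡ x × length w ≡ suc d
        attained with distance-rep dist
        ... | c , c≈j , |c|≡d with word-for (coord-≈ hx (≈-sym c≈j))
        ...   | w , w∈S , w≡x , |w| = w , w∈S , w≡x , trans |w| (cong₂ (λ e m → bit e ℕ.+ m) fx |c|≡d)
        minimal : ∀ w → Word n S w → prod n w ≡ x → suc d ≤ length w
        minimal w w∈S refl with word-coord w∈S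
        ... | t , ht , weight≤ = ℕᵖ.≤-trans (s≤s (distance-≤ dist (coord-unique ht hx)))
                                            (subst (λ e → bit e ℕ.+ ∣ t ∣ ≤ length w) fx weight≤)

      rotation-conj-≤ : ∀ {x t m k} → flip x ≡ false → x has-coord t → ∣ t ∣ ≤ m →
                        ∀ g → WordLength n S (conj g x) k → k ≤ m
      rotation-conj-≤ {x} {t} fx hx |t|≤m g wl with coord-exists g
      ... | tg , hg with conj-rotation g x fx hg hx
      ...   | inj₁ h = ℕᵖ.≤-trans (length-≤ wl h (trans (flip-conj g x) fx)) |t|≤m
      ...   | inj₂ h = ℕᵖ.≤-trans (length-≤ wl h (trans (flip-conj g x) fx))
                                  (subst (_≤ _) (sym (ℤᵖ.∣-i∣≡∣i∣ t)) |t|≤m)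

      reflection-conj-≤ : ∀ {x t D k} → flip x ≡ true → x has-coord t → Bounded t D →
                          ∀ g → WordLength n S (conj g x) k → k ≤ suc D
      reflection-conj-≤ {x} fx hx bounded g wl with coord-exists g
      ... | tg , hg with conj-reflection g x fx hg hx
      ...   | y , h with bounded y
      ...     | c , c≈ , |c|≤D =
        ℕᵖ.≤-trans (length-≤ wl (coord-≈ h (≈-sym c≈)) (trans (flip-conj g x) fx)) (s≤s |c|≤D)

      -- λ₁ = D + 1 when the even classes 2y are within D of 0 and 2k is at distance exactly D:
      -- the extremal conjugate is ρᵏ σ ρ⁻ᵏ, of coordinate 2k.
      lambda1 : ∀ D k → Bounded (+ 0) D → IsDistance (k ℕ.+ k) D → Lambda1 n S (suc D)
      lambda1 D k bounded dist = (pow n ρ k , σ , here refl , extremal) , upper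
        where
        extremal : WordLength n S (conj (pow n ρ k) σ) (suc D)
        extremal = reflection-length (flip-conj (pow n ρ k) σ)
          (conj-reflection-by-rotation (pow n ρ k) σ (flip-pow k) refl (coord-pow k) coord-σ) dist
        upper : ∀ g s m → s ∈ S → WordLength n S (conj g s) m → m ≤ suc D
        upper g _ _ (here refl)                 = reflection-conj-≤ refl coord-σ bounded g
        upper g _ _ (there (here refl))         = rotation-conj-≤ refl coord-ρ (s≤s z≤n) g
        upper g _ _ (there (there (here refl))) = rotation-conj-≤ refl coord-ρ⁻¹ (s≤s z≤n) g

      -- λ₂ = D + 1 when the odd classes 1 + 2y are within D ≥ 1 of 0 and 2k + 1 is at distance
      -- exactly D: products of two letters are rotations ρ⁰, ρ^(±2) or reflections of coordinate ±1,
      -- and the extremal conjugate is ρᵏ (σ ρ⁻¹) ρ⁻ᵏ, of coordinate 2k + 1.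
      lambda2 : ∀ D k → 1 ≤ D → Bounded (+ 1) D → IsDistance (suc (k ℕ.+ k)) D → Lambda2 n S (suc D)
      lambda2 D k 1≤D bounded dist = (pow n ρ k , σ , ρ⁻¹ , here refl , there (there (here refl)) , extremal) , upper
        where
        extremal : WordLength n S (conj (pow n ρ k) (σ ∙ ρ⁻¹)) (suc D)
        extremal = reflection-length (flip-conj (pow n ρ k) (σ ∙ ρ⁻¹))
          (conj-reflection-by-rotation (pow n ρ k) (σ ∙ ρ⁻¹) (flip-pow k) refl (coord-pow k) (coord-· coord-σ coord-ρ⁻¹)) dist
        2≤1+D : 2 ≤ suc D
        2≤1+D = s≤s 1≤D
        bounded⁻ : Bounded (- + 1) D
        bounded⁻ = bounded-shift {+ 1} (- + 1) bounded
        upper : ∀ g s s' m → s ∈ S → s' ∈ S → WordLength n S (conj g (s ∙ s')) m → m ≤ suc D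
        upper g _ _ _ (here refl) (here refl) =
          rotation-conj-≤ refl (coord-· coord-σ coord-σ) z≤n g
        upper g _ _ _ (here refl) (there (here refl)) =
          reflection-conj-≤ refl (coord-· coord-σ coord-ρ) bounded⁻ g
        upper g _ _ _ (here refl) (there (there (here refl))) =
          reflection-conj-≤ refl (coord-· coord-σ coord-ρ⁻¹) bounded g
        upper g _ _ _ (there (here refl)) (here refl) =
          reflection-conj-≤ refl (coord-· coord-ρ coord-σ) bounded g
        upper g _ _ _ (there (here refl)) (there (here refl)) =
          rotation-conj-≤ refl (coord-· coord-ρ coord-ρ) 2≤1+D g
        upper g _ _ _ (there (here refl)) (there (there (here refl))) =
          rotation-conj-≤ refl (coord-· coord-ρ coord-ρ⁻¹) z≤n g
        upper g _ _ _ (there (there (here refl))) (here refl) =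
          reflection-conj-≤ refl (coord-· coord-ρ⁻¹ coord-σ) bounded⁻ g
        upper g _ _ _ (there (there (here refl))) (there (here refl)) =
          rotation-conj-≤ refl (coord-· coord-ρ⁻¹ coord-ρ) z≤n g
        upper g _ _ _ (there (there (here refl))) (there (there (here refl))) =
          rotation-conj-≤ refl (coord-· coord-ρ⁻¹ coord-ρ⁻¹) 2≤1+D g

  divides-residue : ∀ d .{{_ : NonZero d}} r k → d ∣ r ℕ.+ k ℕ.* d → r % d ≡ 0
  divides-residue d r k d∣ = trans (sym ([m+kn]%n≡m%n r k d)) (n∣m⇒m%n≡0 _ d d∣)

  module Values (n : ℕ) .{{_ : NonZero n}} (a b u : ℤ) (u*b≈1 : Congruence._≈_ n (u * b) (+ 1)) where
    open Residues n
    open Generators n a b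
    open Invertible u u*b≈1

    Conclusion : Set
    Conclusion =
      ((4 ∣ n → Lambda1 n S (n / 2 ℕ.+ 1))
        × (2 ∣ n → ¬ (4 ∣ n) → Lambda1 n S (n / 2))
        × (¬ (2 ∣ n) → Lambda1 n S (n / 2 ℕ.+ 1)))
      × ((4 ∣ n → Lambda2 n S (n / 2))
        × (¬ (4 ∣ n) → Lambda2 n S (n / 2 ℕ.+ 1)))

    half-of : ∀ {r h} → n ≡ r ℕ.+ h ℕ.* 2 → r < 2 → n / 2 ≡ h
    half-of {r} {h} n≡ r<2 = trans (cong (_/ 2) n≡)
      (trans (+-distrib-/-∣ʳ r (divides h refl)) (cong₂ ℕ._+_ (m<n⇒m/n≡0 r<2) (m*n/n≡m h 2)))

    half-of+1 : ∀ {r h} → n ≡ r ℕ.+ h ℕ.* 2 → r < 2 → n / 2 ℕ.+ 1 ≡ suc h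
    half-of+1 {h = h} n≡ r<2 = trans (cong (ℕ._+ 1) (half-of n≡ r<2)) (ℕᵖ.+-comm h 1)

    -- n = 4Q with Q = q + 1 (so n/2 = 2Q): λ₁ = 2Q + 1, attained at the half turn j = 2Q;
    -- λ₂ = 2Q, as the odd classes miss the half turn, attained at j = 2Q + 1.
    case-4q : ∀ q → n ≡ suc q ℕ.* 4 → Conclusion
    case-4q q n≡4Q =
      ((λ _ → λ₁) , (λ _ ¬4∣n → contradiction 4∣n ¬4∣n) , (λ ¬2∣n → contradiction 2∣n ¬2∣n)) ,
      ((λ _ → λ₂) , (λ ¬4∣n → contradiction 4∣n ¬4∣n))
      where
      Q = suc q
      n≡2[2Q] : n ≡ Q ℕ.* 2 ℕ.* 2
      n≡2[2Q] = trans n≡4Q (sym (ℕᵖ.*-assoc Q 2 2))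
      n≡2Q+2Q : n ≡ Q ℕ.* 2 ℕ.+ Q ℕ.* 2
      n≡2Q+2Q = trans n≡2[2Q] (double (Q ℕ.* 2))
      4∣n : 4 ∣ n
      4∣n = divides Q n≡4Q
      2∣n : 2 ∣ n
      2∣n = divides (Q ℕ.* 2) n≡2[2Q]
      λ₁ : Lambda1 n S (n / 2 ℕ.+ 1)
      λ₁ = subst (Lambda1 n S) (sym (half-of+1 n≡2[2Q] (s≤s z≤n)))
             (lambda1 (Q ℕ.* 2) Q (bounded-nearest (+ 0) (Q ℕ.* 2) (ℕᵖ.m≤n⇒m≤1+n (ℕᵖ.≤-reflexive n≡2Q+2Q)))
               (near (double Q) (ℕᵖ.≤-reflexive (trans (cong (Q ℕ.* 2 ℕ.+_) (sym (double Q))) (sym n≡2Q+2Q)))))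
      λ₂ : Lambda2 n S (n / 2)
      λ₂ = subst (Lambda2 n S) (sym (half-of n≡2[2Q] (s≤s z≤n)))
             (lambda2 (suc (q ℕ.* 2)) Q (s≤s z≤n)
               (bounded-strict 1 (suc (q ℕ.* 2)) (s≤s (s≤s z≤n)) n≡2Q+2Q
                 (λ odd → ℕᵖ.0≢1+n (trans (sym (m*n%n≡0 Q 2)) odd)))
               (far (subst (suc (q ℕ.* 2) ≤_) (2q+1+2≡2Q+1 q) (ℕᵖ.m≤m+n _ 2)) (trans (2q+1+[2Q+1]≡4Q q) (sym n≡4Q))))
        where 2q+1+2≡2Q+1 : ∀ q → suc (q ℕ.* 2) ℕ.+ 2 ≡ suc (suc q ℕ.+ suc q)
              2q+1+2≡2Q+1 = ℕ-Ring.solve-∀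
              2q+1+[2Q+1]≡4Q : ∀ q → suc (q ℕ.* 2) ℕ.+ suc (suc q ℕ.+ suc q) ≡ suc q ℕ.* 4
              2q+1+[2Q+1]≡4Q = ℕ-Ring.solve-∀

    -- n = 4Q + 1 with Q = q + 1 (so n/2 = 2Q): λ₁ = λ₂ = 2Q + 1, attained at j = 2Q and j = 2Q + 1.
    case-4q+1 : ∀ q → n ≡ 1 ℕ.+ suc q ℕ.* 4 → Conclusion
    case-4q+1 q n≡4Q+1 =
      ((λ 4∣n → contradiction 4∣n ¬4∣n) , (λ 2∣n _ → contradiction 2∣n ¬2∣n) , (λ _ → λ₁)) ,
      ((λ 4∣n → contradiction 4∣n ¬4∣n) , (λ _ → λ₂))
      where
      Q = suc q
      n≡1+2[2Q] : n ≡ 1 ℕ.+ Q ℕ.* 2 ℕ.* 2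
      n≡1+2[2Q] = trans n≡4Q+1 (cong (1 ℕ.+_) (sym (ℕᵖ.*-assoc Q 2 2)))
      n≡1+2Q+2Q : n ≡ suc (Q ℕ.* 2 ℕ.+ Q ℕ.* 2)
      n≡1+2Q+2Q = trans n≡1+2[2Q] (cong suc (double (Q ℕ.* 2)))
      ¬4∣n : ¬ (4 ∣ n)
      ¬4∣n 4∣n = ℕᵖ.1+n≢0 (divides-residue 4 1 Q (subst (4 ∣_) n≡4Q+1 4∣n))
      ¬2∣n : ¬ (2 ∣ n)
      ¬2∣n 2∣n = ℕᵖ.1+n≢0 (divides-residue 2 1 (Q ℕ.* 2) (subst (2 ∣_) n≡1+2[2Q] 2∣n))
      λ₁ : Lambda1 n S (n / 2 ℕ.+ 1)
      λ₁ = subst (Lambda1 n S) (sym (half-of+1 n≡1+2[2Q] (s≤s (s≤s z≤n))))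
             (lambda1 (Q ℕ.* 2) Q (bounded-nearest (+ 0) (Q ℕ.* 2) (ℕᵖ.≤-reflexive n≡1+2Q+2Q))
               (near (double Q) (ℕᵖ.≤-trans (ℕᵖ.≤-reflexive (cong (Q ℕ.* 2 ℕ.+_) (sym (double Q))))
                                            (subst (Q ℕ.* 2 ℕ.+ Q ℕ.* 2 ≤_) (sym n≡1+2Q+2Q) (ℕᵖ.n≤1+n _)))))
      λ₂ : Lambda2 n S (n / 2 ℕ.+ 1)
      λ₂ = subst (Lambda2 n S) (sym (half-of+1 n≡1+2[2Q] (s≤s (s≤s z≤n))))
             (lambda2 (Q ℕ.* 2) Q (s≤s z≤n) (bounded-nearest (+ 1) (Q ℕ.* 2) (ℕᵖ.≤-reflexive n≡1+2Q+2Q))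
               (far (ℕᵖ.m≤n⇒m≤1+n (ℕᵖ.≤-reflexive (double Q)))
                    (trans (ℕᵖ.+-suc (Q ℕ.* 2) (Q ℕ.+ Q))
                           (sym (trans n≡1+2Q+2Q (cong (λ m → suc (Q ℕ.* 2 ℕ.+ m)) (double Q)))))))

    -- n = 4q + 2 (so n/2 = 2q + 1 =: M): λ₁ = M, as the even classes miss the half turn M,
    -- attained at j = 2q; λ₂ = M + 1, attained at the half turn j = M.
    case-4q+2 : ∀ q → n ≡ 2 ℕ.+ q ℕ.* 4 → Conclusion
    case-4q+2 q n≡4q+2 =
      ((λ 4∣n → contradiction 4∣n ¬4∣n) , (λ _ _ → λ₁) , (λ ¬2∣n → contradiction 2∣n ¬2∣n)) ,
      ((λ 4∣n → contradiction 4∣n ¬4∣n) , (λ _ → λ₂))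
      where
      M = suc (q ℕ.* 2)
      n≡2M : n ≡ M ℕ.* 2
      n≡2M = trans n≡4q+2 (4q+2≡2M q)
        where 4q+2≡2M : ∀ q → 2 ℕ.+ q ℕ.* 4 ≡ suc (q ℕ.* 2) ℕ.* 2
              4q+2≡2M = ℕ-Ring.solve-∀
      n≡M+M : n ≡ M ℕ.+ M
      n≡M+M = trans n≡2M (double M)
      ¬4∣n : ¬ (4 ∣ n)
      ¬4∣n 4∣n = ℕᵖ.1+n≢0 (divides-residue 4 2 q (subst (4 ∣_) n≡4q+2 4∣n))
      2∣n : 2 ∣ n
      2∣n = divides M n≡2M
      λ₁ : Lambda1 n S (n / 2)
      λ₁ = subst (Lambda1 n S) (sym (half-of n≡2M (s≤s z≤n)))
             (lambda1 (q ℕ.* 2) q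
               (bounded-strict 0 (q ℕ.* 2) (s≤s z≤n) n≡M+M (λ even → ℕᵖ.1+n≢0 (trans (sym ([m+kn]%n≡m%n 1 q 2)) even)))
               (near (double q) (ℕᵖ.≤-trans (ℕᵖ.≤-reflexive (cong (q ℕ.* 2 ℕ.+_) (sym (double q))))
                                            (subst (q ℕ.* 2 ℕ.+ q ℕ.* 2 ≤_) (sym n≡M+M)
                                              (ℕᵖ.+-mono-≤ (ℕᵖ.n≤1+n _) (ℕᵖ.n≤1+n _))))))
      λ₂ : Lambda2 n S (n / 2 ℕ.+ 1)
      λ₂ = subst (Lambda2 n S) (sym (half-of+1 n≡2M (s≤s z≤n)))
             (lambda2 M q (s≤s z≤n) (bounded-nearest (+ 1) M (ℕᵖ.m≤n⇒m≤1+n (ℕᵖ.≤-reflexive n≡M+M)))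
               (near (cong suc (double q)) (ℕᵖ.≤-reflexive (trans (cong (λ m → M ℕ.+ suc m) (sym (double q))) (sym n≡M+M)))))

    -- n = 4q + 3 (so n/2 = 2q + 1 =: M): λ₁ = λ₂ = M + 1, attained at j = M + 1 and j = M.
    case-4q+3 : ∀ q → n ≡ 3 ℕ.+ q ℕ.* 4 → Conclusion
    case-4q+3 q n≡4q+3 =
      ((λ 4∣n → contradiction 4∣n ¬4∣n) , (λ 2∣n _ → contradiction 2∣n ¬2∣n) , (λ _ → λ₁)) ,
      ((λ 4∣n → contradiction 4∣n ¬4∣n) , (λ _ → λ₂))
      where
      M = suc (q ℕ.* 2)
      n≡1+2M : n ≡ 1 ℕ.+ M ℕ.* 2
      n≡1+2M = trans n≡4q+3 (4q+3≡1+2M q)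
        where 4q+3≡1+2M : ∀ q → 3 ℕ.+ q ℕ.* 4 ≡ 1 ℕ.+ suc (q ℕ.* 2) ℕ.* 2
              4q+3≡1+2M = ℕ-Ring.solve-∀
      n≡1+M+M : n ≡ suc (M ℕ.+ M)
      n≡1+M+M = trans n≡1+2M (cong suc (double M))
      ¬4∣n : ¬ (4 ∣ n)
      ¬4∣n 4∣n = ℕᵖ.1+n≢0 (divides-residue 4 3 q (subst (4 ∣_) n≡4q+3 4∣n))
      ¬2∣n : ¬ (2 ∣ n)
      ¬2∣n 2∣n = ℕᵖ.1+n≢0 (divides-residue 2 1 M (subst (2 ∣_) n≡1+2M 2∣n))
      λ₁ : Lambda1 n S (n / 2 ℕ.+ 1)
      λ₁ = subst (Lambda1 n S) (sym (half-of+1 n≡1+2M (s≤s (s≤s z≤n))))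
             (lambda1 M (suc q) (bounded-nearest (+ 0) M (ℕᵖ.≤-reflexive n≡1+M+M))
               (far (subst (M ≤_) (sym (2[q+1]≡1+M q)) (ℕᵖ.n≤1+n M))
                    (trans (cong (M ℕ.+_) (2[q+1]≡1+M q)) (trans (ℕᵖ.+-suc M M) (sym n≡1+M+M)))))
        where 2[q+1]≡1+M : ∀ q → suc q ℕ.+ suc q ≡ suc (suc (q ℕ.* 2))
              2[q+1]≡1+M = ℕ-Ring.solve-∀
      λ₂ : Lambda2 n S (n / 2 ℕ.+ 1)
      λ₂ = subst (Lambda2 n S) (sym (half-of+1 n≡1+2M (s≤s (s≤s z≤n))))
             (lambda2 M q (s≤s z≤n) (bounded-nearest (+ 1) M (ℕᵖ.≤-reflexive n≡1+M+M))
               (near (cong suc (double q)) (ℕᵖ.≤-trans (ℕᵖ.≤-reflexive (cong (λ m → M ℕ.+ suc m) (sym (double q))))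
                                                       (subst (M ℕ.+ M ≤_) (sym n≡1+M+M) (ℕᵖ.n≤1+n _)))))

    by-residue : 3 ≤ n → ∀ r q → r < 4 → n ≡ r ℕ.+ q ℕ.* 4 → Conclusion
    by-residue n≥3 0 zero    _ n≡0 = contradiction (subst (3 ≤_) n≡0 n≥3) λ ()
    by-residue _   0 (suc q) _ n≡  = case-4q q n≡
    by-residue n≥3 1 zero    _ n≡1 = contradiction (subst (3 ≤_) n≡1 n≥3) λ { (s≤s ()) }
    by-residue _   1 (suc q) _ n≡  = case-4q+1 q n≡
    by-residue _   2 q       _ n≡  = case-4q+2 q n≡
    by-residue _   3 q       _ n≡  = case-4q+3 q n≡
    by-residue _   (suc (suc (suc (suc _)))) _ (s≤s (s≤s (s≤s (s≤s ())))) _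

open import Defs
open import Data.Nat using (ℕ; _+_; _≤_; NonZero)
open import Data.Nat.DivMod using (_/_; _%_; m%n<n; m≡m%n+[m/n]*n)
open import Data.Nat.Divisibility using (_∣_)
open import Data.Integer using (ℤ; -_)
open import Data.Product using (_×_; ∃; _,_)
open import Data.List using (_∷_; [])
open import Relation.Nullary using (¬_)
open import Relation.Binary.PropositionalEquality using (_≡_)

theorem10 : (n : ℕ) .{{_ : NonZero n}} → 3 ≤ n → (a b : ℤ)
    → (∀ k → ∃ λ m → pow n (rpow n b) m ≡ rpow n k)
    → let S = (_·_ n (rpow n a) (fl n)) ∷ rpow n b ∷ rpow n (- b) ∷ [] in
      ((4 ∣ n → Lambda1 n S (n / 2 + 1))
        × (2 ∣ n → ¬ (4 ∣ n) → Lambda1 n S (n / 2))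
        × (¬ (2 ∣ n) → Lambda1 n S (n / 2 + 1)))
      × ((4 ∣ n → Lambda2 n S (n / 2))
        × (¬ (4 ∣ n) → Lambda2 n S (n / 2 + 1)))
theorem10 n n≥3 a b generates with DihedralWordLengths.Generators.unit-of-generator n a b generates
... | u , u*b≈1 = by-residue n≥3 (n % 4) (n / 4) (m%n<n n 4) (m≡m%n+[m/n]*n n 4)
  where
  -- rᵇ generates ⟨r⟩, so b has an inverse u modulo n; the values then depend only on n mod 4.
  open DihedralWordLengths.Values n a b u u*b≈1
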